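{- Let $T$ be a tree with at least three vertices. Then the following properties are equivalent: (1) $T$ is (isomorphic to) a general corona $T'\circ\mathcal{P}$ of some tree $T'$ with respect to some vertex neighborhood partition $\mathcal{P}$ of $T'$. (2) There exists a tree $T'$ such that $T$ is obtained from the $2$-subdivision $S_2(T')$ by a sequence of internal contractions. (3) There exists a tree $T'$ such that $T$ is obtained from the corona $T'\circ K_1$ by a sequence of internal splittings.
   Context: For a graph $G$, a vertex neighborhood partition of $G$ is a family $\mathcal{P}=\{\mathcal{P}(v): v\in V(G)\}$ where each $\mathcal{P}(v)$ is a partition of the neighborhood $N_G(v)$ into nonempty parts. The general corona ($\mathcal{P}$-corona) $G\circ\mathcal{P}$ is the graph with vertex set $\{(v,1): v\in V(G)\}\cup\bigcup_{v\in V(G)}\{(v,A): A\in\mathcal{P}(v)\}$ and edge set $\bigcup_{v\in V(G)}\{(v,1)(v,A): A\in\mathcal{P}(v)\}\cup\bigcup_{uv\in E(G)}\{(v,A)(u,B): u\in A,\ v\in B\}$. The vertices $(v,1)$ are called external, the set of them is $Ext(G\circ\mathcal{P})$, and all other vertices $(v,A)$ are called internal. If $\mathcal{P}(v)=\{N_G(v)\}$ for all $v$, then $G\circ\mathcal{P}$ is the corona $G\circ K_1$ (the graph obtained from $G$ by attaching one new pendant vertex to each vertex); if $\mathcal{P}(v)=\{\{u\}: u\in N_G(v)\}$ for all $v$, then $G\circ\mathcal{P}$ is the $2$-subdivision $S_2(G)$ (each edge $uv$ replaced by a path $u,x_1,x_2,v$ with new vertices $x_1,x_2$). An internal contraction in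 a general corona $G\circ\mathcal{P}$ merges two internal vertices $(v,A),(v,B)$ with $A\neq B$, $A,B\in\mathcal{P}(v)$, into a single vertex adjacent to all neighbors of $(v,A)$ or $(v,B)$; the result is $G\circ\mathcal{P}'$ with $\mathcal{P}'(v)=(\mathcal{P}(v)\setminus\{A,B\})\cup\{A\cup B\}$ and $\mathcal{P}'(x)=\mathcal{P}(x)$ for $x\neq v$. An internal splitting is the reverse operation (replacing an internal vertex $(v,C)$ by $(v,A),(v,B)$ for a partition $C=A\cup B$ into nonempty disjoint sets, correspondingly refining $\mathcal{P}(v)$). -}

module Defs where

open import Level using (0ℓ)
open import Data.Nat using (ℕ; _≤_; _<_)
open import Data.Fin using (Fin)
open import Data.Fin.Subset using (Subset; _∈_; _∪_; ⁅_⁆)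
open import Data.List using (List; []; _∷_; length; _++_; lookup)
open import Data.List.Relation.Unary.Unique.Propositional using (Unique)
open import Data.List.Relation.Unary.Linked using (Linked)
import Data.List.Membership.Propositional as LM
open import Data.Product using (Σ; ∃; _×_; _,_)
open import Data.Sum using (_⊎_; inj₁; inj₂)
open import Data.Empty using (⊥)
open import Relation.Binary.PropositionalEquality using (_≡_; _≢_)
open import Relation.Nullary using (¬_)
open import Relation.Binary.Construct.Closure.ReflexiveTransitive using (Star)
open import Function.Bundles using (_↔_; _⇔_; Inverse)

record Graph (n : ℕ) : Set₁ where
  field
    Adj    : Fin n → Fin n → Set
    sym    : ∀ {x y} → Adj x y → Adj y x
    irrefl : ∀ {x} → ¬ Adj x x
open Graph public

module _ {n : ℕ} (G : Graph n) where

  Connected : Set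
  Connected = ∀ x y → Star (Adj G) x y

  Cycle : Set
  Cycle = Σ (Fin n) λ x → Σ (List (Fin n)) λ xs →
            2 ≤ length xs × Unique (x ∷ xs) × Linked (Adj G) (x ∷ xs ++ x ∷ [])

  Acyclic : Set
  Acyclic = ¬ Cycle

  IsTree : Set
  IsTree = 0 < n × Connected × Acyclic

record NbhdPartition {n : ℕ} (G : Graph n) : Set where
  field
    parts    : Fin n → List (Subset n)
    nonempty : ∀ v (i : Fin (length (parts v))) → ∃ λ u → u ∈ lookup (parts v) i
    inNbhd   : ∀ v (i : Fin (length (parts v))) u → u ∈ lookup (parts v) i → Adj G v u
    covers   : ∀ v u → Adj G v u → ∃ λ (i : Fin (length (parts v))) → u ∈ lookup (parts v) i
    disjoint : ∀ v (i j : Fin (length (parts v))) u →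
               u ∈ lookup (parts v) i → u ∈ lookup (parts v) j → i ≡ j
open NbhdPartition public

module _ {n : ℕ} {G : Graph n} (P : NbhdPartition G) where

  -- inj₁ v        : the external vertex (v,1)
  -- inj₂ (v , i)  : the internal vertex (v,A) where A is the i-th part of P(v)
  CVertex : Set
  CVertex = Fin n ⊎ Σ (Fin n) (λ v → Fin (length (parts P v)))

  CAdj : CVertex → CVertex → Set
  CAdj (inj₁ v) (inj₁ w) = ⊥
  CAdj (inj₁ v) (inj₂ (w , i)) = v ≡ w
  CAdj (inj₂ (w , i)) (inj₁ v) = w ≡ v
  CAdj (inj₂ (v , i)) (inj₂ (u , j)) =
    Adj G u v × u ∈ lookup (parts P v) i × v ∈ lookup (parts P u) j

record Iso {n : ℕ} (G : Graph n) (V : Set) (E : V → V → Set) : Set where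
  field
    bij   : Fin n ↔ V
    preserves : ∀ x y → Adj G x y ⇔ E (Inverse.to bij x) (Inverse.to bij y)

_≅Corona_ : ∀ {n m} {T' : Graph m} → Graph n → NbhdPartition T' → Set
T ≅Corona P = Iso T (CVertex P) (CAdj P)

-- Internal contraction: P' arises from P by merging two distinct parts
-- A , B of P(v) into A ∪ B (families compared as sets of parts).

module _ {n : ℕ} {G : Graph n} where

  _∈ₗ_ : Subset n → List (Subset n) → Set
  _∈ₗ_ = LM._∈_

  InternalContraction : NbhdPartition G → NbhdPartition G → Set
  InternalContraction P P' =
    Σ (Fin n) λ v → Σ (Subset n) λ A → Σ (Subset n) λ B →
      A ∈ₗ parts P v × B ∈ₗ parts P v × A ≢ B ×
      (∀ C → C ∈ₗ parts P' v ⇔ (C ≡ A ∪ B ⊎ (C ∈ₗ parts P v × C ≢ A × C ≢ B))) ×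
      (∀ w → w ≢ v → ∀ C → C ∈ₗ parts P' w ⇔ C ∈ₗ parts P w)

  InternalSplitting : NbhdPartition G → NbhdPartition G → Set
  InternalSplitting P P' = InternalContraction P' P

  -- P(v) = {{u} : u ∈ N(v)} for all v, i.e. G ∘ P = S₂(G)
  IsSubdivisionPartition : NbhdPartition G → Set
  IsSubdivisionPartition P = ∀ v (i : Fin (length (parts P v))) → ∃ λ u → lookup (parts P v) i ≡ ⁅ u ⁆

  -- P(v) = {N(v)} for all v, i.e. G ∘ P = G ∘ K₁
  IsCoronaPartition : NbhdPartition G → Set
  IsCoronaPartition P = ∀ v → ∃ λ A → parts P v ≡ A ∷ []

module _ {n : ℕ} (T : Graph n) where

  Property1 : Set₁
  Property1 = Σ ℕ λ m → Σ (Graph m) λ T' → IsTree T' ×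
                Σ (NbhdPartition T') λ P → T ≅Corona P

  Property2 : Set₁
  Property2 = Σ ℕ λ m → Σ (Graph m) λ T' → IsTree T' ×
                Σ (NbhdPartition T') λ P₀ → Σ (NbhdPartition T') λ P →
                  IsSubdivisionPartition P₀ × Star InternalContraction P₀ P × T ≅Corona P

  Property3 : Set₁
  Property3 = Σ ℕ λ m → Σ (Graph m) λ T' → IsTree T' ×
                Σ (NbhdPartition T') λ P₀ → Σ (NbhdPartition T') λ P →
                  IsCoronaPartition P₀ × Star InternalSplitting P₀ P × T ≅Corona P

-- (2) and (3) each give (1) by forgetting the sequence of operations. Conversely, let T ≅ T' ∘ P.
-- Splitting a part A with u ∈ A into {u} and A - u is an internal splitting that lowers
-- Σ_v Σ_{A ∈ P(v)} (|A| - 1); repeating it ends at the all-singleton partition, i.e. at S₂(T').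
-- Merging two parts of one neighbourhood is an internal contraction that lowers the total
-- number of parts; repeating it ends with at most one part per vertex, which is the partition
-- of T' ∘ K₁ as soon as every vertex of T' has a neighbour. That holds because T' is connected
-- and has at least two vertices: a one-vertex T' has no internal vertices, so its corona has
-- only one vertex while T has three.

module Submission where

open import Data.Empty using (⊥; ⊥-elim)
open import Data.Fin using (Fin; zero; suc; _≟_; punchIn)
open import Data.Fin.Properties using (any?; punchInᵢ≢i)
open import Data.Fin.Subset using (Subset; _∈_; _∉_; _⊆_; _∪_; _-_; ⁅_⁆; ∣_∣; Nonempty)
open import Data.Fin.Subset.Properties
  using (_∈?_; x∈⁅x⁆; x∈⁅y⁆⇒x≡y; x∈p∪q⁺; x∈p∪q⁻; p⊆p∪q; q⊆p∪q; ⊆-antisym; p─q⊆p;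
         x∈p∧x≢y⇒x∈p-y; x∈p⇒∣p-x∣<∣p∣; ∣⁅x⁆∣≡1; ∣⊥∣≡0; ⊥⊆; ∉⊥; p⊂q⇒∣p∣<∣q∣)
open import Data.List using (List; []; _∷_; [_]; _++_; length; lookup; map)
open import Data.List.Membership.Propositional using (find; lose) renaming (_∈_ to _∈ₗ_)
open import Data.List.Membership.Propositional.Properties using (∈-∃++; ∈-lookup)
open import Data.List.Properties using (tabulate-lookup)
open import Data.List.Relation.Binary.Permutation.Propositional
  using (_↭_; ↭-sym; ↭-reflexive; ↭⇒↭ₛ)
open import Data.List.Relation.Binary.Permutation.Propositional.Properties
  using (All-resp-↭; Any-resp-↭; ∈-resp-↭; shift; map⁺)
import Data.List.Relation.Binary.Permutation.Setoid.Properties as Setoid↭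
open import Data.List.Relation.Unary.All as All using (All; []; _∷_)
open import Data.List.Relation.Unary.AllPairs using (AllPairs; []; _∷_; head)
import Data.List.Relation.Unary.AllPairs.Properties as AllPairs
open import Data.List.Relation.Unary.Any using (Any; here; there; index)
open import Data.List.Relation.Unary.Any.Properties using (lookup-index)
open import Data.Nat using (ℕ; zero; suc; _+_; _∸_; _≤_; _<_; s≤s; z≤n)
open import Data.Nat.Induction using (<-wellFounded)
import Data.Nat.ListAction as ℕₗ
open import Data.Nat.ListAction.Properties using (sum-↭)
open import Data.Nat.Properties
  using (+-0-commutativeMonoid; +-monoˡ-<; ∸-monoˡ-<; ≤-refl; ≤-trans; n≤1+n; module ≤-Reasoning)
open import Algebra.Properties.CommutativeMonoid.Sum +-0-commutativeMonoid
  using (sum; sum-remove; sum-cong-≗)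
open import Data.Product using (∃; ∃-syntax; _×_; _,_; proj₂)
open import Data.Sum using (_⊎_; inj₁; inj₂; [_,_]′)
open import Data.Vec using (_∷_; here; there)
open import Data.Vec.Functional using (Vector; updateAt; removeAt)
open import Data.Vec.Functional.Properties using (updateAt-updates; updateAt-minimal)
open import Defs hiding (_∈ₗ_; sym)
open import Function using (const)
open import Function.Bundles using (_⇔_; _↔_; mk⇔; Inverse; Injection)
open import Function.Properties.Equivalence using () renaming (refl to ⇔-refl; trans to ⇔-trans)
open import Function.Properties.Inverse using (↔⇒↣)
open import Induction.WellFounded using (Acc; acc)
open import Level using (0ℓ)
open import Relation.Binary using (Rel)
open import Relation.Binary.Construct.Closure.ReflexiveTransitive using (Star; ε; _◅_; _◅◅_)
open import Relation.Binary.PropositionalEquality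
  using (_≡_; _≢_; refl; sym; trans; cong; subst; setoid)
open import Relation.Nullary using (yes; no; ¬?; contradiction)
open import Relation.Nullary.Decidable using (_×-dec_)
open import Relation.Unary using (Pred)

module _ {a ℓ p} {A : Set a} (_⟶_ : Rel A ℓ) (μ : A → ℕ) (Normal : Pred A p) where

  normal-form-reachable : (∀ x → Normal x ⊎ ∃[ y ] (y ⟶ x × μ y < μ x)) →
                          ∀ x → ∃[ x₀ ] (Normal x₀ × Star _⟶_ x₀ x)
  normal-form-reachable step x = go x (<-wellFounded (μ x))
    where
    go : ∀ x → Acc _<_ (μ x) → ∃[ x₀ ] (Normal x₀ × Star _⟶_ x₀ x)
    go x (acc rs) with step x
    ... | inj₁ normal = x , normal , ε
    ... | inj₂ (y , y⟶x , μy<μx) =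
      let x₀ , normal , x₀⟶⋆y = go y (rs μy<μx) in x₀ , normal , x₀⟶⋆y ◅◅ y⟶x ◅ ε

star⇒step : ∀ {a ℓ} {A : Set a} {R : Rel A ℓ} {x y} → Star R x y → x ≢ y → ∃ (R x)
star⇒step ε x≢x = ⊥-elim (x≢x refl)
star⇒step (r ◅ _) _ = _ , r

∀⊎∃ : ∀ {n p q} {P : Pred (Fin n) p} {Q : Pred (Fin n) q} →
      (∀ i → P i ⊎ Q i) → (∀ i → P i) ⊎ ∃ Q
∀⊎∃ {zero} _ = inj₁ λ ()
∀⊎∃ {suc n} p⊎q with p⊎q zero | ∀⊎∃ (λ i → p⊎q (suc i))
... | inj₂ q₀ | _ = inj₂ (zero , q₀)
... | inj₁ _ | inj₂ (i , qᵢ) = inj₂ (suc i , qᵢ)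
... | inj₁ p₀ | inj₁ ps = inj₁ λ { zero → p₀ ; (suc i) → ps i }

All⊎Any : ∀ {a p q} {A : Set a} {P : Pred A p} {Q : Pred A q} {xs} →
          All (λ x → P x ⊎ Q x) xs → All P xs ⊎ Any Q xs
All⊎Any [] = inj₁ []
All⊎Any (inj₂ qx ∷ _) = inj₂ (here qx)
All⊎Any (inj₁ px ∷ p⊎qs) with All⊎Any p⊎qs
... | inj₁ ps = inj₁ (px ∷ ps)
... | inj₂ qs = inj₂ (there qs)

singleton⊎twoOrMore : ∀ {a p} {A : Set a} {P : Pred A p} {xs : List A} → Any P xs →
                      (∃[ x ] xs ≡ x ∷ []) ⊎ (∃[ x ] ∃[ y ] ∃[ ys ] xs ≡ x ∷ y ∷ ys)
singleton⊎twoOrMore {xs = x ∷ []} _ = inj₁ (x , refl)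
singleton⊎twoOrMore {xs = x ∷ y ∷ ys} _ = inj₂ (x , y , ys , refl)

sum-<-at : ∀ {n} (f g : Vector ℕ n) (v : Fin n) →
           g v < f v → (∀ w → w ≢ v → g w ≡ f w) → sum g < sum f
sum-<-at {suc n} f g v gv<fv g≡f = begin-strict
  sum g                     ≡⟨ sum-remove {i = v} g ⟩
  g v + sum (removeAt g v)  ≡⟨ cong (g v +_) (sum-cong-≗ λ j → g≡f _ (punchInᵢ≢i v j)) ⟩
  g v + sum (removeAt f v)  <⟨ +-monoˡ-< _ gv<fv ⟩
  f v + sum (removeAt f v)  ≡⟨ sum-remove {i = v} f ⟨
  sum f                     ∎
  where open ≤-Reasoning

x∉p-x : ∀ {n} {p : Subset n} x → x ∉ p - x
x∉p-x {p = _ ∷ _} zero ()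
x∉p-x {p = _ ∷ _} (suc x) (there x∈p-x) = x∉p-x x x∈p-x

module _ {n : ℕ} where

  x∈p⇒0<∣p∣ : ∀ {p : Subset n} {x} → x ∈ p → 0 < ∣ p ∣
  x∈p⇒0<∣p∣ {p} {x} x∈p = subst (_< ∣ p ∣) (∣⊥∣≡0 n) (p⊂q⇒∣p∣<∣q∣ (⊥⊆ , x , x∈p , ∉⊥))

  x∈p⇒⁅x⁆∪p-x≡p : ∀ {p : Subset n} {x} → x ∈ p → ⁅ x ⁆ ∪ (p - x) ≡ p
  x∈p⇒⁅x⁆∪p-x≡p {p} {x} x∈p = ⊆-antisym ⊆p p⊆
    where
    ⊆p : ⁅ x ⁆ ∪ (p - x) ⊆ p
    ⊆p y∈ with x∈p∪q⁻ ⁅ x ⁆ (p - x) y∈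
    ... | inj₁ y∈⁅x⁆ = subst (_∈ p) (sym (x∈⁅y⁆⇒x≡y x y∈⁅x⁆)) x∈p
    ... | inj₂ y∈p-x = p─q⊆p p ⁅ x ⁆ y∈p-x
    p⊆ : p ⊆ ⁅ x ⁆ ∪ (p - x)
    p⊆ {y} y∈p with y ≟ x
    ... | yes refl = x∈p∪q⁺ (inj₁ (x∈⁅x⁆ x))
    ... | no y≢x = x∈p∪q⁺ (inj₂ (x∈p∧x≢y⇒x∈p-y y∈p y≢x))

  Singleton : Subset n → Set
  Singleton p = ∃[ x ] p ≡ ⁅ x ⁆

  HasTwoElements : Subset n → Set
  HasTwoElements p = ∃[ x ] ∃[ y ] (x ∈ p × y ∈ p × y ≢ x)

  singleton⊎hasTwoElements : ∀ {p} → Nonempty p → Singleton p ⊎ HasTwoElements p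
  singleton⊎hasTwoElements {p} (x , x∈p) with any? (λ y → y ∈? p ×-dec ¬? (y ≟ x))
  ... | yes (y , y∈p , y≢x) = inj₂ (x , y , x∈p , y∈p , y≢x)
  ... | no ∄y = inj₁ (x , ⊆-antisym p⊆⁅x⁆ ⁅x⁆⊆p)
    where
    p⊆⁅x⁆ : p ⊆ ⁅ x ⁆
    p⊆⁅x⁆ {y} y∈p with y ≟ x
    ... | yes refl = x∈⁅x⁆ x
    ... | no y≢x = ⊥-elim (∄y (y , y∈p , y≢x))
    ⁅x⁆⊆p : ⁅ x ⁆ ⊆ p
    ⁅x⁆⊆p y∈⁅x⁆ = subst (_∈ p) (sym (x∈⁅y⁆⇒x≡y x y∈⁅x⁆)) x∈p

  Disjoint : Rel (Subset n) 0ℓ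
  Disjoint p q = ∀ {x} → x ∈ p → x ∈ q → ⊥

  Disjoint-sym : ∀ {p q} → Disjoint p q → Disjoint q p
  Disjoint-sym p#q x∈q x∈p = p#q x∈p x∈q

  Disjoint-antimonoˡ : ∀ {p q r} → p ⊆ q → Disjoint q r → Disjoint p r
  Disjoint-antimonoˡ p⊆q q#r x∈p = q#r (p⊆q x∈p)

  ∪-Disjoint : ∀ {p q r} → Disjoint p r → Disjoint q r → Disjoint (p ∪ q) r
  ∪-Disjoint {p} {q} p#r q#r x∈p∪q = [ p#r , q#r ]′ (x∈p∪q⁻ p q x∈p∪q)

  nonempty-disjoint⇒≢ : ∀ {p q} → Nonempty p → Disjoint p q → q ≢ p
  nonempty-disjoint⇒≢ (_ , x∈p) p#q refl = p#q x∈p x∈p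

module _ {n : ℕ} where

  open Setoid↭ (setoid (Subset n)) using (AllPairs-resp-↭)

  record IsPartition (N : Pred (Fin n) 0ℓ) (L : List (Subset n)) : Set where
    field
      allNonempty      : All Nonempty L
      allWithin        : All (λ A → ∀ {u} → u ∈ A → N u) L
      covering         : ∀ {u} → N u → Any (u ∈_) L
      pairwiseDisjoint : AllPairs Disjoint L
  open IsPartition public

  excess : List (Subset n) → ℕ
  excess L = ℕₗ.sum (map (λ A → ∣ A ∣ ∸ 1) L)

  module _ {N : Pred (Fin n) 0ℓ} where

    IsPartition-resp-↭ : ∀ {L L'} → L ↭ L' → IsPartition N L → IsPartition N L'
    IsPartition-resp-↭ L↭L' π = record
      { allNonempty      = All-resp-↭ L↭L' (allNonempty π)
      ; allWithin        = All-resp-↭ L↭L' (allWithin π)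
      ; covering         = λ u∈N → Any-resp-↭ L↭L' (covering π u∈N)
      ; pairwiseDisjoint = AllPairs-resp-↭ Disjoint-sym
          ((λ { refl d → d }) , (λ { refl d → d })) (↭⇒↭ₛ L↭L') (pairwiseDisjoint π)
      }

    merge-isPartition : ∀ {A B R} → IsPartition N (A ∷ B ∷ R) → IsPartition N (A ∪ B ∷ R)
    merge-isPartition {A} {B} π
      with allNonempty π | allWithin π | pairwiseDisjoint π
    ... | (u , u∈A) ∷ _ ∷ ne | A⊆N ∷ B⊆N ∷ ⊆N | (_ ∷ A#R) ∷ B#R ∷ #R = record
      { allNonempty      = (u , x∈p∪q⁺ (inj₁ u∈A)) ∷ ne
      ; allWithin        = (λ u∈A∪B → [ A⊆N , B⊆N ]′ (x∈p∪q⁻ A B u∈A∪B)) ∷ ⊆N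
      ; covering         = λ u∈N → merged (covering π u∈N)
      ; pairwiseDisjoint =
          All.tabulate (λ C∈R → ∪-Disjoint (All.lookup A#R C∈R) (All.lookup B#R C∈R)) ∷ #R
      }
      where
      merged : ∀ {u} → Any (u ∈_) (A ∷ B ∷ _) → Any (u ∈_) (A ∪ B ∷ _)
      merged (here u∈A)          = here (x∈p∪q⁺ (inj₁ u∈A))
      merged (there (here u∈B))  = here (x∈p∪q⁺ (inj₂ u∈B))
      merged (there (there u∈R)) = there u∈R

    split-isPartition : ∀ {A B R} → Nonempty A → Nonempty B → Disjoint A B →
                        IsPartition N (A ∪ B ∷ R) → IsPartition N (A ∷ B ∷ R)
    split-isPartition {A} {B} neA neB A#B π
      with allNonempty π | allWithin π | pairwiseDisjoint π
    ... | _ ∷ ne | A∪B⊆N ∷ ⊆N | A∪B#R ∷ #R = record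
      { allNonempty      = neA ∷ neB ∷ ne
      ; allWithin        = (λ u∈A → A∪B⊆N (p⊆p∪q B u∈A)) ∷ (λ u∈B → A∪B⊆N (q⊆p∪q A B u∈B)) ∷ ⊆N
      ; covering         = λ u∈N → split (covering π u∈N)
      ; pairwiseDisjoint = (A#B ∷ All.map (Disjoint-antimonoˡ (p⊆p∪q B)) A∪B#R)
                         ∷ All.map (Disjoint-antimonoˡ (q⊆p∪q A B)) A∪B#R ∷ #R
      }
      where
      split : ∀ {u} → Any (u ∈_) (A ∪ B ∷ _) → Any (u ∈_) (A ∷ B ∷ _)
      split (here u∈A∪B) = [ here , (λ u∈B → there (here u∈B)) ]′ (x∈p∪q⁻ A B u∈A∪B)
      split (there u∈R)  = there (there u∈R)

    merge-membership : ∀ {A B R} → IsPartition N (A ∷ B ∷ R) → ∀ C →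
      C ∈ₗ A ∪ B ∷ R ⇔ (C ≡ A ∪ B ⊎ (C ∈ₗ A ∷ B ∷ R × C ≢ A × C ≢ B))
    merge-membership {A} {B} {R} π C with allNonempty π | pairwiseDisjoint π
    ... | neA ∷ neB ∷ _ | (_ ∷ A#R) ∷ B#R ∷ _ = mk⇔ to from
      where
      to : C ∈ₗ A ∪ B ∷ R → C ≡ A ∪ B ⊎ (C ∈ₗ A ∷ B ∷ R × C ≢ A × C ≢ B)
      to (here C≡A∪B) = inj₁ C≡A∪B
      to (there C∈R)  = inj₂ (there (there C∈R) ,
                              nonempty-disjoint⇒≢ neA (All.lookup A#R C∈R) ,
                              nonempty-disjoint⇒≢ neB (All.lookup B#R C∈R))
      from : C ≡ A ∪ B ⊎ (C ∈ₗ A ∷ B ∷ R × C ≢ A × C ≢ B) → C ∈ₗ A ∪ B ∷ R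
      from (inj₁ C≡A∪B)                        = here C≡A∪B
      from (inj₂ (here C≡A , C≢A , _))         = ⊥-elim (C≢A C≡A)
      from (inj₂ (there (here C≡B) , _ , C≢B)) = ⊥-elim (C≢B C≡B)
      from (inj₂ (there (there C∈R) , _))      = there C∈R

    split-off : ∀ {L A u w} → IsPartition N L → A ∈ₗ L → u ∈ A → w ∈ A → w ≢ u →
      ∃[ R ] (IsPartition N (⁅ u ⁆ ∷ (A - u) ∷ R) × L ↭ ⁅ u ⁆ ∪ (A - u) ∷ R ×
              excess (⁅ u ⁆ ∷ (A - u) ∷ R) < excess L)
    split-off {A = A} {u} {w} π A∈L u∈A w∈A w≢u with ∈-∃++ A∈L
    ... | xs , ys , refl = xs ++ ys , π' , L↭ , excess-<
      where
      A≡ : ⁅ u ⁆ ∪ (A - u) ≡ A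
      A≡ = x∈p⇒⁅x⁆∪p-x≡p u∈A
      w∈A-u : w ∈ A - u
      w∈A-u = x∈p∧x≢y⇒x∈p-y w∈A w≢u
      L↭ : xs ++ [ A ] ++ ys ↭ ⁅ u ⁆ ∪ (A - u) ∷ xs ++ ys
      L↭ = subst (λ B → _ ↭ B ∷ xs ++ ys) (sym A≡) (shift A xs ys)
      π' : IsPartition N (⁅ u ⁆ ∷ (A - u) ∷ xs ++ ys)
      π' = split-isPartition (u , x∈⁅x⁆ u) (w , w∈A-u)
             (λ v∈⁅u⁆ → subst (_∉ A - u) (sym (x∈⁅y⁆⇒x≡y u v∈⁅u⁆)) (x∉p-x u))
             (IsPartition-resp-↭ L↭ π)
      excess-< : excess (⁅ u ⁆ ∷ (A - u) ∷ xs ++ ys) < excess (xs ++ [ A ] ++ ys)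
      excess-< = begin-strict
        (∣ ⁅ u ⁆ ∣ ∸ 1) + excess ((A - u) ∷ xs ++ ys)
          ≡⟨ cong (λ k → k ∸ 1 + excess ((A - u) ∷ xs ++ ys)) (∣⁅x⁆∣≡1 u) ⟩
        (∣ A - u ∣ ∸ 1) + excess (xs ++ ys)
          <⟨ +-monoˡ-< _ (∸-monoˡ-< (x∈p⇒∣p-x∣<∣p∣ u∈A) (x∈p⇒0<∣p∣ w∈A-u)) ⟩
        excess (A ∷ xs ++ ys)
          ≡⟨ sum-↭ (map⁺ _ (↭-sym (shift A xs ys))) ⟩
        excess (xs ++ [ A ] ++ ys)
          ∎
        where open ≤-Reasoning

  All-from-lookup : ∀ {Q : Pred (Subset n) 0ℓ} {L : List (Subset n)} →
                    (∀ i → Q (lookup L i)) → All Q L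
  All-from-lookup {Q} q = All.tabulate λ A∈L → subst Q (sym (lookup-index A∈L)) (q (index A∈L))

  AllPairs-Disjoint-lookup : ∀ {L : List (Subset n)} → AllPairs Disjoint L →
                             ∀ i j u → u ∈ lookup L i → u ∈ lookup L j → i ≡ j
  AllPairs-Disjoint-lookup (_ ∷ _) zero zero _ _ _ = refl
  AllPairs-Disjoint-lookup (A#R ∷ _) zero (suc j) _ u∈A u∈Rⱼ =
    ⊥-elim (All.lookup A#R (∈-lookup j) u∈A u∈Rⱼ)
  AllPairs-Disjoint-lookup (A#R ∷ _) (suc i) zero _ u∈Rᵢ u∈A =
    ⊥-elim (All.lookup A#R (∈-lookup i) u∈A u∈Rᵢ)
  AllPairs-Disjoint-lookup (_ ∷ #R) (suc i) (suc j) u u∈Rᵢ u∈Rⱼ =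
    cong suc (AllPairs-Disjoint-lookup #R i j u u∈Rᵢ u∈Rⱼ)

  lookup-Disjoint-AllPairs : ∀ (L : List (Subset n)) →
                             (∀ i j u → u ∈ lookup L i → u ∈ lookup L j → i ≡ j) →
                             AllPairs Disjoint L
  lookup-Disjoint-AllPairs L disjoint = subst (AllPairs Disjoint) (tabulate-lookup L)
    (AllPairs.tabulate⁺ λ i≢j u∈Lᵢ u∈Lⱼ → i≢j (disjoint _ _ _ u∈Lᵢ u∈Lⱼ))

module _ {m : ℕ} {T : Graph m} where

  isPartition : (P : NbhdPartition T) (v : Fin m) → IsPartition (Adj T v) (parts P v)
  isPartition P v = record
    { allNonempty      = All-from-lookup (nonempty P v)
    ; allWithin        = All-from-lookup (λ i u∈ → inNbhd P v i _ u∈)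
    ; covering         = λ v~u → let i , u∈Lᵢ = covers P v _ v~u in lose (∈-lookup i) u∈Lᵢ
    ; pairwiseDisjoint = lookup-Disjoint-AllPairs (parts P v) (disjoint P v)
    }

  fromIsPartition : (ps : Fin m → List (Subset m)) → (∀ v → IsPartition (Adj T v) (ps v)) →
                    NbhdPartition T
  fromIsPartition ps π = record
    { parts    = ps
    ; nonempty = λ v i → All.lookup (allNonempty (π v)) (∈-lookup i)
    ; inNbhd   = λ v i u u∈Lᵢ → All.lookup (allWithin (π v)) (∈-lookup i) u∈Lᵢ
    ; covers   = λ v u v~u → let u∈L = covering (π v) v~u in index u∈L , lookup-index u∈L
    ; disjoint = λ v → AllPairs-Disjoint-lookup (pairwiseDisjoint (π v))
    }

  replace : (P : NbhdPartition T) (v : Fin m) (L : List (Subset m)) →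
            IsPartition (Adj T v) L → NbhdPartition T
  replace P v L π = fromIsPartition (updateAt (parts P) v (const L)) updated
    where
    updated : ∀ w → IsPartition (Adj T w) (updateAt (parts P) v (const L) w)
    updated w with w ≟ v
    ... | yes refl = subst (IsPartition (Adj T w)) (sym (updateAt-updates w (parts P))) π
    ... | no w≢v = subst (IsPartition (Adj T w)) (sym (updateAt-minimal w v (parts P) w≢v))
                     (isPartition P w)

  total : (List (Subset m) → ℕ) → NbhdPartition T → ℕ
  total f P = sum (λ v → f (parts P v))

  total-replace-< : ∀ f P v {L} (π : IsPartition (Adj T v) L) →
                    f L < f (parts P v) → total f (replace P v L π) < total f P
  total-replace-< f P v π fL<fPv = sum-<-at _ _ v
    (subst (λ L → f L < f (parts P v)) (sym (updateAt-updates v (parts P))) fL<fPv)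
    (λ w w≢v → cong f (updateAt-minimal w v (parts P) w≢v))

  contraction-from-merge : ∀ {P P' : NbhdPartition T} {v A B R} →
    parts P v ≡ A ∷ B ∷ R → parts P' v ↭ A ∪ B ∷ R →
    (∀ w → w ≢ v → parts P' w ≡ parts P w) → InternalContraction P P'
  contraction-from-merge {P} {P'} {v} {A} {B} {R} Pv≡ P'v↭ P'≡P =
    v , A , B , A∈Pv , B∈Pv , nonempty-disjoint⇒≢ neB (Disjoint-sym A#B) , P'v⇔ , P'w⇔
    where
    π : IsPartition (Adj T v) (A ∷ B ∷ R)
    π = subst (IsPartition (Adj T v)) Pv≡ (isPartition P v)
    neB : Nonempty B
    neB = All.lookup (allNonempty π) (there (here refl))
    A#B : Disjoint A B
    A#B = All.head (head (pairwiseDisjoint π))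
    A∈Pv : A ∈ₗ parts P v
    A∈Pv = subst (A ∈ₗ_) (sym Pv≡) (here refl)
    B∈Pv : B ∈ₗ parts P v
    B∈Pv = subst (B ∈ₗ_) (sym Pv≡) (there (here refl))
    P'v⇔ : ∀ C → C ∈ₗ parts P' v ⇔ (C ≡ A ∪ B ⊎ (C ∈ₗ parts P v × C ≢ A × C ≢ B))
    P'v⇔ C = ⇔-trans (mk⇔ (∈-resp-↭ P'v↭) (∈-resp-↭ (↭-sym P'v↭)))
      (subst (λ L → C ∈ₗ A ∪ B ∷ R ⇔ (C ≡ A ∪ B ⊎ (C ∈ₗ L × C ≢ A × C ≢ B)))
             (sym Pv≡) (merge-membership π C))
    P'w⇔ : ∀ w → w ≢ v → ∀ C → C ∈ₗ parts P' w ⇔ C ∈ₗ parts P w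
    P'w⇔ w w≢v C = subst (λ L → C ∈ₗ L ⇔ C ∈ₗ parts P w) (sym (P'≡P w w≢v)) ⇔-refl

  merge-step : ∀ P v {A B R} → parts P v ≡ A ∷ B ∷ R →
               ∃[ P' ] (InternalContraction P P' × total length P' < total length P)
  merge-step P v {A} {B} {R} Pv≡ =
    P' ,
    contraction-from-merge {P = P} {P' = P'} Pv≡ (↭-reflexive (updateAt-updates v (parts P)))
      (λ w w≢v → updateAt-minimal w v (parts P) w≢v) ,
    total-replace-< length P v π' (subst (λ L → length (A ∪ B ∷ R) < length L) (sym Pv≡) ≤-refl)
    where
    π' : IsPartition (Adj T v) (A ∪ B ∷ R)
    π' = merge-isPartition (subst (IsPartition (Adj T v)) Pv≡ (isPartition P v))
    P' : NbhdPartition T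
    P' = replace P v (A ∪ B ∷ R) π'

  split-step : ∀ P v {A u w} → A ∈ₗ parts P v → u ∈ A → w ∈ A → w ≢ u →
               ∃[ P' ] (InternalContraction P' P × total excess P' < total excess P)
  split-step P v A∈Pv u∈A w∈A w≢u with split-off (isPartition P v) A∈Pv u∈A w∈A w≢u
  ... | R , π' , Pv↭ , excess-< =
    replace P v _ π' ,
    contraction-from-merge {P = replace P v _ π'} {P' = P} (updateAt-updates v (parts P)) Pv↭
      (λ w w≢v → sym (updateAt-minimal w v (parts P) w≢v)) ,
    total-replace-< excess P v π' excess-<

  corona-step : (∀ v → ∃ (Adj T v)) → ∀ P →
    IsCoronaPartition P ⊎ ∃[ P' ] (InternalSplitting P' P × total length P' < total length P)
  corona-step neighbour P
    with ∀⊎∃ (λ v → singleton⊎twoOrMore (covering (isPartition P v) (proj₂ (neighbour v))))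
  ... | inj₁ onePart = inj₁ onePart
  ... | inj₂ (v , _ , _ , _ , Pv≡) = inj₂ (merge-step P v Pv≡)

  subdivision-step : ∀ P →
    IsSubdivisionPartition P ⊎ ∃[ P' ] (InternalContraction P' P × total excess P' < total excess P)
  subdivision-step P
    with ∀⊎∃ (λ v → All⊎Any (All.map singleton⊎hasTwoElements (allNonempty (isPartition P v))))
  ... | inj₁ singletons = inj₁ λ v i → All.lookup (singletons v) (∈-lookup i)
  ... | inj₂ (v , splittable) with find splittable
  ...   | A , A∈Pv , u , w , u∈A , w∈A , w≢u = inj₂ (split-step P v A∈Pv u∈A w∈A w≢u)

corona-base-≥2 : ∀ {n m} {T : Graph n} {T' : Graph m} (P : NbhdPartition T') →
                 T ≅Corona P → 2 ≤ n → 2 ≤ m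
corona-base-≥2 {m = 0} P iso (s≤s (s≤s _)) with Inverse.to (Iso.bij iso) zero
... | inj₁ ()
... | inj₂ (() , _)
corona-base-≥2 {n} {m = 1} {T' = T'} P iso (s≤s (s≤s _)) =
  contradiction (Injection.injective (↔⇒↣ bij) (trans (external (Inverse.to bij zero))
                                               (sym (external (Inverse.to bij (suc zero))))))
                λ ()
  where
  bij : Fin n ↔ CVertex P
  bij = Iso.bij iso
  external : (c : CVertex P) → c ≡ inj₁ zero
  external (inj₁ zero) = refl
  external (inj₂ (zero , i)) with nonempty P zero i
  ... | zero , u∈Aᵢ = ⊥-elim (irrefl T' (inNbhd P zero i zero u∈Aᵢ))
corona-base-≥2 {m = suc (suc _)} _ _ _ = s≤s (s≤s z≤n)

connected⇒neighbour : ∀ {m} {G : Graph m} → Connected G → 2 ≤ m → ∀ v → ∃ (Adj G v)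
connected⇒neighbour connected (s≤s (s≤s _)) v =
  star⇒step (connected v (punchIn v zero)) (λ v≡ → punchInᵢ≢i v zero (sym v≡))

mainTheorem1 : (n : ℕ) (T : Graph n) → IsTree T → 3 ≤ n →
                 (Property1 T ⇔ Property2 T) × (Property1 T ⇔ Property3 T)
mainTheorem1 n T _ 3≤n = mk⇔ 1⇒2 2⇒1 , mk⇔ 1⇒3 3⇒1
  where
  1⇒2 : Property1 T → Property2 T
  1⇒2 (m , T' , tree , P , iso) =
    let P₀ , subdivision , P₀⇝P =
          normal-form-reachable InternalContraction (total excess) IsSubdivisionPartition
            subdivision-step P
    in m , T' , tree , P₀ , P , subdivision , P₀⇝P , iso
  1⇒3 : Property1 T → Property3 T
  1⇒3 (m , T' , tree@(_ , connected , _) , P , iso) =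
    let 2≤m = corona-base-≥2 {T = T} P iso (≤-trans (n≤1+n 2) 3≤n)
        neighbour = connected⇒neighbour {G = T'} connected 2≤m
        P₀ , corona , P₀⇝P =
          normal-form-reachable InternalSplitting (total length) IsCoronaPartition
            (corona-step neighbour) P
    in m , T' , tree , P₀ , P , corona , P₀⇝P , iso
  2⇒1 : Property2 T → Property1 T
  2⇒1 (m , T' , tree , _ , P , _ , _ , iso) = m , T' , tree , P , iso
  3⇒1 : Property3 T → Property1 T
  3⇒1 (m , T' , tree , _ , P , _ , _ , iso) = m , T' , tree , P , iso
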